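{- There are no bi-unitary harmonic numbers of the form $p^3q^2$, where $p$ and $q$ are distinct primes.
   Context: A divisor $d$ of $n$ is a unitary divisor if $\gcd(d,n/d)=1$; a divisor $d$ of $n$ is a bi-unitary divisor if the greatest common unitary divisor of $d$ and $n/d$ is $1$. $\sigma^{**}(n)$ denotes the sum and $d^{**}(n)$ the number of bi-unitary divisors of $n$. $n$ is bi-unitary harmonic if $\sigma^{**}(n)\mid n\,d^{**}(n)$. -}

module Defs where

open import Data.Bool using (Bool; true; false; _∧_)
open import Data.Nat using (ℕ; zero; suc; _*_; _⊔_; _≡ᵇ_)
open import Data.Nat.Divisibility using (_∣_; _∣?_)
open import Data.Nat.DivMod using (_/_)
open import Data.Nat.GCD using (gcd)
open import Data.List using (List; map; upTo; filterᵇ; foldr; length)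
open import Data.Nat.ListAction using (sum)
open import Relation.Nullary.Decidable using (⌊_⌋)

range1 : ℕ → List ℕ
range1 m = map suc (upTo m)

isUnitaryDivisor : ℕ → ℕ → Bool
isUnitaryDivisor zero    m = false
isUnitaryDivisor (suc k) m = ⌊ suc k ∣? m ⌋ ∧ (gcd (suc k) (m / suc k) ≡ᵇ 1)

gcud : ℕ → ℕ → ℕ
gcud a b = foldr _⊔_ 0
  (filterᵇ (λ e → isUnitaryDivisor e a ∧ isUnitaryDivisor e b) (range1 a))

isBiUnitaryDivisor : ℕ → ℕ → Bool
isBiUnitaryDivisor zero    n = false
isBiUnitaryDivisor (suc k) n = ⌊ suc k ∣? n ⌋ ∧ (gcud (suc k) (n / suc k) ≡ᵇ 1)

biUnitaryDivisors : ℕ → List ℕ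
biUnitaryDivisors n = filterᵇ (λ d → isBiUnitaryDivisor d n) (range1 n)

σ** : ℕ → ℕ
σ** n = sum (biUnitaryDivisors n)

d** : ℕ → ℕ
d** n = length (biUnitaryDivisors n)

BiUnitaryHarmonic : ℕ → Set
BiUnitaryHarmonic n = σ** n ∣ n * d** n

-- After general facts (primes, coprimality, the p-part of a divisor, the Defs
-- predicates and gcud) the proof has two halves, combined at the end.
-- (1) Every divisor of p^I q^J is p^i q^j with unique i ≤ I, j ≤ J; it is
--     unitary iff i ∈ {0, I} and j ∈ {0, J}.  So p^i q^j and its complement
--     p^(I-i) q^(J-j) share a non-trivial unitary divisor iff i or j is a
--     non-zero half of I resp. J: the bi-unitary divisors are the p^i q^j with
--     "admissible" exponents.  For p³q² (i ≤ 3, j ∈ {0, 2}) this gives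
--     σ** = (1+p)(1+p²)(1+q²) and d** = 8.
-- (2) (1+p)(1+p²)(1+q²) never divides 8p³q²: q = 2 forces p = 5, p = 2 forces
--     q = 3, and for odd p, q one gets 1 + p ∣ 8, so p ∈ {3, 7} and q = 5;
--     the remaining pairs fail by computation.
module Submission where

open import Defs
open import Data.Nat using (ℕ; _*_; _^_)
open import Data.Nat.Primality using (Prime)
open import Relation.Binary.PropositionalEquality using (_≢_)
open import Relation.Nullary using (¬_)

open import Data.Bool using (T; T?; _∧_)
open import Data.Bool.Properties using (T-∧)
open import Data.Empty using (⊥-elim)
open import Data.List using (List; []; _∷_; foldr; upTo; filter; filterᵇ; cartesianProductWith)
open import Data.List.Membership.Propositional using (_∈_)
open import Data.List.Membership.Propositional.Properties
  using (∈-map⁺; ∈-upTo⁺; ∈-upTo⁻; ∈-filter⁺; ∈-filter⁻;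
         ∈-cartesianProductWith⁺; ∈-cartesianProductWith⁻)
open import Data.List.Membership.Propositional.Properties.WithK using (unique∧set⇒bag)
open import Data.List.Relation.Binary.BagAndSetEquality using (∼bag⇒↭)
open import Data.List.Relation.Binary.Permutation.Propositional using (_↭_)
open import Data.List.Relation.Binary.Permutation.Propositional.Properties using (↭-length)
open import Data.List.Relation.Unary.Any using (here; there)
open import Data.List.Relation.Unary.Unique.Propositional using (Unique)
import Data.List.Relation.Unary.Unique.Propositional.Properties as Unique
open import Data.Nat
  using (zero; suc; _+_; _∸_; _⊔_; _≤_; _<_; z≤n; s≤s; NonZero; _≟_; _≤?_; _≡ᵇ_;
         >-nonZero⁻¹; nonTrivial⇒≢1; nonTrivial⇒n>1)
open import Data.Nat.Properties
open import Data.Nat.Divisibility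
open import Data.Nat.DivMod using (_/_; m*n/n≡m)
open import Data.Nat.GCD using (gcd; gcd-zeroˡ)
open import Data.Nat.Coprimality
  using (Coprime; coprime⇒gcd≡1; gcd≡1⇒coprime; coprime-divisor; 1-coprimeTo)
import Data.Nat.Coprimality as Coprime
open import Data.Nat.Primality
  using (prime⇒irreducible; prime⇒nonZero; prime⇒nonTrivial; euclidsLemma; prime[2]; prime?)
open import Data.Nat.ListAction using (sum)
open import Data.Nat.ListAction.Properties using (sum-↭)
open import Data.Nat.Tactic.RingSolver using (solve-∀)
open import Data.Product using (_×_; _,_; proj₁; proj₂; ∃-syntax)
open import Data.Sum using (_⊎_; inj₁; inj₂; [_,_]′)
open import Function using (_∘_)
open import Function.Bundles using (_⇔_; mk⇔; Equivalence)
open import Relation.Binary.PropositionalEquality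
  using (_≡_; refl; sym; trans; cong; cong₂; subst; subst₂; module ≡-Reasoning)
open import Relation.Nullary using (yes; no; Dec; contradiction)
open import Relation.Nullary.Decidable using (⌊_⌋; _→-dec_; toWitness; fromWitness; from-yes; from-no)

open Equivalence using (to; from)

prime≢1 : ∀ {p} → Prime p → p ≢ 1
prime≢1 pp = nonTrivial⇒≢1 {{prime⇒nonTrivial pp}}

prime∤1 : ∀ {p} → Prime p → ¬ p ∣ 1
prime∤1 pp = prime≢1 pp ∘ ∣1⇒≡1

prime∣prime⇒≡ : ∀ {p q} → Prime p → Prime q → p ∣ q → p ≡ q
prime∣prime⇒≡ pp pq p∣q with prime⇒irreducible pq p∣q
... | inj₁ p≡1 = ⊥-elim (prime≢1 pp p≡1)
... | inj₂ p≡q = p≡q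

prime∣^⇒≡ : ∀ {p q} k → Prime p → Prime q → p ∣ q ^ k → p ≡ q
prime∣^⇒≡ zero pp pq p∣1 = ⊥-elim (prime∤1 pp p∣1)
prime∣^⇒≡ {q = q} (suc k) pp pq p∣q^k+1 with euclidsLemma q (q ^ k) pp p∣q^k+1
... | inj₁ p∣q   = prime∣prime⇒≡ pp pq p∣q
... | inj₂ p∣q^k = prime∣^⇒≡ k pp pq p∣q^k

prime∣^*⇒≡ : ∀ {r p m} k → Prime r → Prime p → ¬ r ∣ m → r ∣ p ^ k * m → r ≡ p
prime∣^*⇒≡ {p = p} {m} k pr pp r∤m r∣ with euclidsLemma (p ^ k) m pr r∣
... | inj₁ r∣p^k = prime∣^⇒≡ k pr pp r∣p^k
... | inj₂ r∣m   = ⊥-elim (r∤m r∣m)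

prime∤1+p* : ∀ {p} m → Prime p → ¬ p ∣ 1 + p * m
prime∤1+p* {p} m pp p∣ =
  prime∤1 pp (∣m+n∣m⇒∣n (subst (p ∣_) (+-comm 1 (p * m)) p∣) (m∣m*n m))

prime∤⇒coprime : ∀ {p m} → Prime p → ¬ p ∣ m → Coprime p m
prime∤⇒coprime pp p∤m (i∣p , i∣m) with prime⇒irreducible pp i∣p
... | inj₁ i≡1 = i≡1
... | inj₂ refl = ⊥-elim (p∤m i∣m)

coprime-*ʳ : ∀ {m a b} → Coprime m a → Coprime m b → Coprime m (a * b)
coprime-*ʳ {m} {a} m⊥a m⊥b {i} (i∣m , i∣ab) = m⊥b (i∣m , coprime-divisor i⊥a i∣ab)
  where
  i⊥a : Coprime i a
  i⊥a (j∣i , j∣a) = m⊥a (∣-trans j∣i i∣m , j∣a)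

coprime-*ˡ : ∀ {m a b} → Coprime a m → Coprime b m → Coprime (a * b) m
coprime-*ˡ a⊥m b⊥m = Coprime.sym (coprime-*ʳ (Coprime.sym a⊥m) (Coprime.sym b⊥m))

coprime-^ʳ : ∀ {m a} k → Coprime m a → Coprime m (a ^ k)
coprime-^ʳ zero    _   = Coprime.sym (1-coprimeTo _)
coprime-^ʳ (suc k) m⊥a = coprime-*ʳ m⊥a (coprime-^ʳ k m⊥a)

coprime-^ : ∀ {a b} k l → Coprime a b → Coprime (a ^ k) (b ^ l)
coprime-^ k l a⊥b = coprime-^ʳ l (Coprime.sym (coprime-^ʳ k (Coprime.sym a⊥b)))

cancel-prime-power : ∀ {r d m} k → Prime r → ¬ r ∣ d → d ∣ r ^ k * m → d ∣ m
cancel-prime-power k pr r∤d =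
  coprime-divisor (coprime-^ʳ k (Coprime.sym (prime∤⇒coprime pr r∤d)))

p∣p^1+k* : ∀ p k m → p ∣ p ^ suc k * m
p∣p^1+k* p k m = ∣m⇒∣m*n m (m∣m*n (p ^ k))

-- Every divisor of p^a · m is p^i · e with i ≤ a and e ∣ m: split off factors p
-- while p divides d, and cancel p^a once it does not.
divisor-split : ∀ {p d m} a → Prime p → d ∣ p ^ a * m →
  ∃[ i ] ∃[ e ] (i ≤ a × d ≡ p ^ i * e × e ∣ m)
divisor-split {d = d} {m} zero pp d∣ =
  0 , d , z≤n , sym (*-identityˡ d) , subst (d ∣_) (*-identityˡ m) d∣
divisor-split {p} {d} {m} (suc a) pp d∣ with p ∣? d
... | no p∤d = 0 , d , z≤n , sym (*-identityˡ d) , cancel-prime-power (suc a) pp p∤d d∣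
... | yes (divides d′ refl)
  with divisor-split a pp
         (*-cancelˡ-∣ p {{prime⇒nonZero pp}} (subst₂ _∣_ (*-comm d′ p) (*-assoc p (p ^ a) m) d∣))
...   | i , e , i≤a , refl , e∣m =
  suc i , e , s≤s i≤a , trans (*-comm (p ^ i * e) p) (sym (*-assoc p (p ^ i) e)) , e∣m

prime-power-unique : ∀ {p m m′} a c → Prime p → ¬ p ∣ m → ¬ p ∣ m′ →
  p ^ a * m ≡ p ^ c * m′ → a ≡ c × m ≡ m′
prime-power-unique {m = m} {m′} zero zero _ _ _ eq =
  refl , trans (sym (*-identityˡ m)) (trans eq (*-identityˡ m′))
prime-power-unique {p} {m} {m′} zero (suc c) _ p∤m _ eq =
  ⊥-elim (p∤m (subst (p ∣_) (trans (sym eq) (*-identityˡ m)) (p∣p^1+k* p c m′)))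
prime-power-unique {p} {m} {m′} (suc a) zero _ _ p∤m′ eq =
  ⊥-elim (p∤m′ (subst (p ∣_) (trans eq (*-identityˡ m′)) (p∣p^1+k* p a m)))
prime-power-unique {p} {m} {m′} (suc a) (suc c) pp p∤m p∤m′ eq
  with prime-power-unique a c pp p∤m p∤m′
         (*-cancelˡ-≡ _ _ p {{prime⇒nonZero pp}}
           (trans (sym (*-assoc p (p ^ a) m)) (trans eq (*-assoc p (p ^ c) m′))))
... | refl , m≡m′ = refl , m≡m′

divides∧≡1 : ∀ d m x → T (⌊ d ∣? m ⌋ ∧ (x ≡ᵇ 1)) ⇔ (d ∣ m × x ≡ 1)
divides∧≡1 d m x = mk⇔
  (λ t → let d∣m , x≡ᵇ1 = to T-∧ t in toWitness d∣m , ≡ᵇ⇒≡ x 1 x≡ᵇ1)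
  (λ (d∣m , x≡1) → from T-∧ (fromWitness d∣m , ≡⇒≡ᵇ x 1 x≡1))

unitary-spec : ∀ {d m} .{{_ : NonZero d}} →
  T (isUnitaryDivisor d m) ⇔ (d ∣ m × gcd d (m / d) ≡ 1)
unitary-spec {suc k} {m} = divides∧≡1 (suc k) m _

biUnitary-spec : ∀ {d n} .{{_ : NonZero d}} →
  T (isBiUnitaryDivisor d n) ⇔ (d ∣ n × gcud d (n / d) ≡ 1)
biUnitary-spec {suc k} {n} = divides∧≡1 (suc k) n _

unitary-cofactor : ∀ {d e m} .{{_ : NonZero d}} → m ≡ e * d →
  T (isUnitaryDivisor d m) ⇔ gcd d e ≡ 1
unitary-cofactor {d} {e} refl = mk⇔
  (λ u → subst (λ x → gcd d x ≡ 1) (m*n/n≡m e d) (proj₂ (to unitary-spec u)))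
  (λ g → from unitary-spec (divides e refl , subst (λ x → gcd d x ≡ 1) (sym (m*n/n≡m e d)) g))

biUnitary-cofactor : ∀ {d e n} .{{_ : NonZero d}} → n ≡ e * d →
  T (isBiUnitaryDivisor d n) ⇔ gcud d e ≡ 1
biUnitary-cofactor {d} {e} refl = mk⇔
  (λ b → subst (λ x → gcud d x ≡ 1) (m*n/n≡m e d) (proj₂ (to biUnitary-spec b)))
  (λ g → from biUnitary-spec (divides e refl , subst (λ x → gcud d x ≡ 1) (sym (m*n/n≡m e d)) g))

unitary⇒∣ : ∀ {d m} → T (isUnitaryDivisor d m) → d ∣ m
unitary⇒∣ {suc k} u = proj₁ (to unitary-spec u)

biUnitary⇒∣ : ∀ {d n} → T (isBiUnitaryDivisor d n) → d ∣ n
biUnitary⇒∣ {suc k} b = proj₁ (to biUnitary-spec b)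

unitary-1 : ∀ m → T (isUnitaryDivisor 1 m)
unitary-1 m = from unitary-spec (1∣ m , gcd-zeroˡ (m / 1))

∈-range1⁺ : ∀ {k m} → k < m → suc k ∈ range1 m
∈-range1⁺ k<m = ∈-map⁺ suc (∈-upTo⁺ k<m)

∣⇒∈-range1 : ∀ {d m} .{{_ : NonZero d}} .{{_ : NonZero m}} → d ∣ m → d ∈ range1 m
∣⇒∈-range1 {suc k} d∣m = ∈-range1⁺ (∣⇒≤ d∣m)

∈-biUnitaryDivisors : ∀ {x n} .{{_ : NonZero n}} →
  x ∈ biUnitaryDivisors n ⇔ T (isBiUnitaryDivisor x n)
∈-biUnitaryDivisors {x} {n} = mk⇔ (proj₂ ∘ ∈-filter⁻ bu? {xs = range1 n}) in-list
  where
  bu? : ∀ d → Dec (T (isBiUnitaryDivisor d n))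
  bu? d = T? (isBiUnitaryDivisor d n)
  in-list : ∀ {d} → T (isBiUnitaryDivisor d n) → d ∈ biUnitaryDivisors n
  in-list {suc k} b = ∈-filter⁺ bu? (∣⇒∈-range1 (biUnitary⇒∣ b)) b

unique-biUnitaryDivisors : ∀ n → Unique (biUnitaryDivisors n)
unique-biUnitaryDivisors n =
  Unique.filter⁺ (λ d → T? (isBiUnitaryDivisor d n))
    (Unique.map⁺ suc-injective (Unique.upTo⁺ n))

max-upper : ∀ {x xs} → x ∈ xs → x ≤ foldr _⊔_ 0 xs
max-upper {x} {y ∷ ys} (here refl) = m≤m⊔n x _
max-upper {x} {y ∷ ys} (there x∈) = ≤-trans (max-upper x∈) (m≤n⊔m y _)

max-least : ∀ {b} xs → (∀ {x} → x ∈ xs → x ≤ b) → foldr _⊔_ 0 xs ≤ b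
max-least []         _     = z≤n
max-least (x ∷ xs) bound = ⊔-lub (bound (here refl)) (max-least xs (bound ∘ there))

module _ {a b : ℕ} where

  private
    common? : ∀ e → Dec (T (isUnitaryDivisor e a ∧ isUnitaryDivisor e b))
    common? e = T? (isUnitaryDivisor e a ∧ isUnitaryDivisor e b)

  gcud-upper : ∀ {e} → e ≤ a → T (isUnitaryDivisor e a) → T (isUnitaryDivisor e b) → e ≤ gcud a b
  gcud-upper {suc k} e≤a ua ub = max-upper (∈-filter⁺ common? (∈-range1⁺ e≤a) (from T-∧ (ua , ub)))

  gcud≡1 : 1 ≤ a → (∀ e → T (isUnitaryDivisor e a) → T (isUnitaryDivisor e b) → e ≡ 1) →
    gcud a b ≡ 1
  gcud≡1 1≤a only-1 = ≤-antisym (max-least _ at-most-1) (gcud-upper 1≤a (unitary-1 a) (unitary-1 b))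
    where
    at-most-1 : ∀ {x} → x ∈ filterᵇ _ (range1 a) → x ≤ 1
    at-most-1 x∈ with ∈-filter⁻ common? {xs = range1 a} x∈
    ... | _ , t with to T-∧ t
    ...   | ua , ub = ≤-reflexive (only-1 _ ua ub)

  gcud≡1⇒common≡1 : .{{_ : NonZero a}} → gcud a b ≡ 1 →
    ∀ {e} → T (isUnitaryDivisor e a) → T (isUnitaryDivisor e b) → e ≡ 1
  gcud≡1⇒common≡1 g {suc k} ua ub =
    ≤-antisym (subst (suc k ≤_) g (gcud-upper (∣⇒≤ (unitary⇒∣ ua)) ua ub)) (s≤s z≤n)

-- The exponents x ∈ {0, I}: p^x is a unitary divisor of p^I exactly for these.
Extreme : ℕ → ℕ → Set
Extreme x I = x ≡ 0 ⊎ x ≡ I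

extreme⇒≤ : ∀ {x I} → Extreme x I → x ≤ I
extreme⇒≤ (inj₁ refl) = z≤n
extreme⇒≤ (inj₂ refl) = ≤-refl

extreme⇔ : ∀ {x I} → x ≤ I → (x ≡ 0 ⊎ I ∸ x ≡ 0) ⇔ Extreme x I
extreme⇔ {x} {I} x≤I = mk⇔ fwd bwd
  where
  fwd : x ≡ 0 ⊎ I ∸ x ≡ 0 → Extreme x I
  fwd (inj₁ x≡0)   = inj₁ x≡0
  fwd (inj₂ I∸x≡0) = inj₂ (≤-antisym x≤I (m∸n≡0⇒m≤n I∸x≡0))
  bwd : Extreme x I → x ≡ 0 ⊎ I ∸ x ≡ 0
  bwd (inj₁ x≡0) = inj₁ x≡0
  bwd (inj₂ refl) = inj₂ (n∸n≡0 x)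

-- The exponents i ≤ I for which p^i is a bi-unitary divisor of p^I:
-- i must not be a non-zero half of I.
Admissible : ℕ → ℕ → Set
Admissible i I = i + i ≡ I → i ≡ 0

admissible? : ∀ i I → Dec (Admissible i I)
admissible? i I = (i + i ≟ I) →-dec (i ≟ 0)

half-complement : ∀ {i I} → i + i ≡ I → I ∸ i ≡ i
half-complement {i} refl = m+n∸m≡n i i

-- An exponent extreme both for i and for the complementary I ∸ i is 0,
-- provided i is admissible: this is why complementary parts share no
-- non-trivial unitary divisor.
extreme-complement : ∀ {x i I} → i ≤ I → Admissible i I →
  Extreme x i → Extreme x (I ∸ i) → x ≡ 0
extreme-complement _ _ (inj₁ x≡0) _ = x≡0
extreme-complement _ _ (inj₂ _) (inj₁ x≡0) = x≡0
extreme-complement {i = i} i≤I admissible (inj₂ refl) (inj₂ i≡I∸i) =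
  admissible (trans (cong (i +_) i≡I∸i) (m+[n∸m]≡n i≤I))

admissibleExponents : ℕ → List ℕ
admissibleExponents I = filter (λ i → admissible? i I) (upTo (suc I))

∈-admissibleExponents : ∀ {i I} → i ∈ admissibleExponents I ⇔ (i ≤ I × Admissible i I)
∈-admissibleExponents {i} {I} = mk⇔
  (λ i∈ → let i∈upTo , adm = ∈-filter⁻ (λ k → admissible? k I) {xs = upTo (suc I)} i∈
          in ≤-pred (∈-upTo⁻ i∈upTo) , adm)
  (λ (i≤I , adm) → ∈-filter⁺ (λ k → admissible? k I) (∈-upTo⁺ (s≤s i≤I)) adm)

unique-admissibleExponents : ∀ I → Unique (admissibleExponents I)
unique-admissibleExponents I = Unique.filter⁺ (λ k → admissible? k I) (Unique.upTo⁺ (suc I))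

σ-p³q² : ℕ → ℕ → ℕ
σ-p³q² p q = (1 + p) * (1 + p * p) * (1 + q * q)

module TwoPrimes {p q : ℕ} (pp : Prime p) (pq : Prime q) (p≢q : p ≢ q) where

  P : ℕ → ℕ → ℕ
  P i j = p ^ i * q ^ j

  P≢0 : ∀ i j → NonZero (P i j)
  P≢0 i j = m*n≢0 (p ^ i) (q ^ j) {{m^n≢0 p i {{prime⇒nonZero pp}}}} {{m^n≢0 q j {{prime⇒nonZero pq}}}}

  p⊥q : Coprime p q
  p⊥q = prime∤⇒coprime pp (p≢q ∘ prime∣prime⇒≡ pp pq)

  p∤q^ : ∀ j → ¬ p ∣ q ^ j
  p∤q^ j = p≢q ∘ prime∣^⇒≡ j pp pq

  P-divisor : ∀ {d} I J → d ∣ P I J → ∃[ i ] ∃[ j ] (i ≤ I × j ≤ J × d ≡ P i j)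
  P-divisor I J d∣ with divisor-split I pp d∣
  ... | i , e , i≤I , refl , e∣q^J
    with divisor-split {m = 1} J pq (subst (e ∣_) (sym (*-identityʳ (q ^ J))) e∣q^J)
  ...   | j , f , j≤J , refl , f∣1 with ∣1⇒≡1 f∣1
  ...     | refl = i , j , i≤I , j≤J , cong (p ^ i *_) (*-identityʳ (q ^ j))

  P-injective : ∀ {i i′ j j′} → P i j ≡ P i′ j′ → i ≡ i′ × j ≡ j′
  P-injective {i} {i′} {j} {j′} eq with prime-power-unique i i′ pp (p∤q^ j) (p∤q^ j′) eq
  ... | refl , q^j≡q^j′
    with prime-power-unique {m = 1} {m′ = 1} j j′ pq (prime∤1 pq) (prime∤1 pq) (cong (_* 1) q^j≡q^j′)
  ...   | refl , _ = refl , refl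

  ^-split : ∀ r {i I} → i ≤ I → r ^ I ≡ r ^ i * r ^ (I ∸ i)
  ^-split r {i} {I} i≤I = trans (cong (r ^_) (sym (m+[n∸m]≡n i≤I))) (^-distribˡ-+-* r i (I ∸ i))

  P-split : ∀ {i j I J} → i ≤ I → j ≤ J → P I J ≡ P (I ∸ i) (J ∸ j) * P i j
  P-split {i} {j} {I} {J} i≤I j≤J = begin
    p ^ I * q ^ J                                   ≡⟨ cong₂ _*_ (^-split p i≤I) (^-split q j≤J) ⟩
    (p ^ i * p ^ (I ∸ i)) * (q ^ j * q ^ (J ∸ j))   ≡⟨ interchange (p ^ i) _ (q ^ j) _ ⟩
    P (I ∸ i) (J ∸ j) * P i j                       ∎
    where
    open ≡-Reasoning
    interchange : ∀ a b c d → (a * b) * (c * d) ≡ (b * d) * (a * c)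
    interchange = solve-∀

  coprime-P⇔ : ∀ {x y x′ y′} →
    Coprime (P x y) (P x′ y′) ⇔ ((x ≡ 0 ⊎ x′ ≡ 0) × (y ≡ 0 ⊎ y′ ≡ 0))
  coprime-P⇔ {x} {y} {x′} {y′} = mk⇔ exponents coprime
    where
    p-exponent : ∀ x x′ → Coprime (P x y) (P x′ y′) → x ≡ 0 ⊎ x′ ≡ 0
    p-exponent zero    _        _ = inj₁ refl
    p-exponent (suc _) zero     _ = inj₂ refl
    p-exponent (suc a) (suc a′) c =
      ⊥-elim (prime≢1 pp (c (p∣p^1+k* p a (q ^ y) , p∣p^1+k* p a′ (q ^ y′))))
    q-exponent : ∀ y y′ → Coprime (P x y) (P x′ y′) → y ≡ 0 ⊎ y′ ≡ 0
    q-exponent zero    _        _ = inj₁ refl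
    q-exponent (suc _) zero     _ = inj₂ refl
    q-exponent (suc b) (suc b′) c =
      ⊥-elim (prime≢1 pq (c (∣n⇒∣m*n (p ^ x) (m∣m*n (q ^ b)) ,
                             ∣n⇒∣m*n (p ^ x′) (m∣m*n (q ^ b′)))))
    exponents : Coprime (P x y) (P x′ y′) → (x ≡ 0 ⊎ x′ ≡ 0) × (y ≡ 0 ⊎ y′ ≡ 0)
    exponents c = p-exponent x x′ c , q-exponent y y′ c
    same-prime : ∀ r {k k′} → k ≡ 0 ⊎ k′ ≡ 0 → Coprime (r ^ k) (r ^ k′)
    same-prime r (inj₁ refl) = 1-coprimeTo _
    same-prime r (inj₂ refl) = Coprime.sym (1-coprimeTo _)
    coprime : (x ≡ 0 ⊎ x′ ≡ 0) × (y ≡ 0 ⊎ y′ ≡ 0) → Coprime (P x y) (P x′ y′)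
    coprime (x-zero , y-zero) = coprime-*ˡ
      (coprime-*ʳ (same-prime p x-zero) (coprime-^ x y′ p⊥q))
      (coprime-*ʳ (coprime-^ y x′ (Coprime.sym p⊥q)) (same-prime q y-zero))

  unitary-P⁺ : ∀ {x y I J} → Extreme x I → Extreme y J → T (isUnitaryDivisor (P x y) (P I J))
  unitary-P⁺ {x} {y} {I} {J} ex ey =
    from (unitary-cofactor {{P≢0 x y}} (P-split x≤I y≤J))
      (coprime⇒gcd≡1 (from coprime-P⇔ (from (extreme⇔ x≤I) ex , from (extreme⇔ y≤J) ey)))
    where
    x≤I : x ≤ I
    x≤I = extreme⇒≤ ex
    y≤J : y ≤ J
    y≤J = extreme⇒≤ ey

  unitary-P⁻ : ∀ {e} I J → T (isUnitaryDivisor e (P I J)) →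
    ∃[ x ] ∃[ y ] (e ≡ P x y × Extreme x I × Extreme y J)
  unitary-P⁻ {e} I J u with P-divisor I J (unitary⇒∣ {e} u)
  ... | x , y , x≤I , y≤J , refl =
    let x-zero , y-zero = to coprime-P⇔
          (gcd≡1⇒coprime (to (unitary-cofactor {{P≢0 x y}} (P-split x≤I y≤J)) u))
    in x , y , refl , to (extreme⇔ x≤I) x-zero , to (extreme⇔ y≤J) y-zero

  -- P i j is a bi-unitary divisor of P I J when both exponents are admissible:
  -- a common unitary divisor P x y of P i j and P (I ∸ i) (J ∸ j) has extreme
  -- exponents on both sides, hence x = y = 0.
  biUnitary-P⁺ : ∀ {i j I J} → i ≤ I → j ≤ J → Admissible i I → Admissible j J →
    T (isBiUnitaryDivisor (P i j) (P I J))
  biUnitary-P⁺ {i} {j} {I} {J} i≤I j≤J adm-i adm-j =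
    from (biUnitary-cofactor {{P≢0 i j}} (P-split i≤I j≤J))
      (gcud≡1 (>-nonZero⁻¹ (P i j) {{P≢0 i j}}) only-1)
    where
    only-1 : ∀ e → T (isUnitaryDivisor e (P i j)) → T (isUnitaryDivisor e (P (I ∸ i) (J ∸ j))) → e ≡ 1
    only-1 e u u′ with unitary-P⁻ {e} i j u | unitary-P⁻ {e} (I ∸ i) (J ∸ j) u′
    ... | x , y , refl , ex , ey | x′ , y′ , P≡P′ , ex′ , ey′ with P-injective {x} {x′} {y} {y′} P≡P′
    ...   | refl , refl =
      cong₂ P (extreme-complement i≤I adm-i ex ex′) (extreme-complement j≤J adm-j ey ey′)

  -- Every bi-unitary divisor of P I J is P i j with admissible exponents:
  -- if i were a non-zero half of I, p^i would be a non-trivial common unitary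
  -- divisor of P i j and its complement P i (J ∸ j) (likewise for j).
  biUnitary-P⁻ : ∀ {d} I J → T (isBiUnitaryDivisor d (P I J)) →
    ∃[ i ] ∃[ j ] (i ≤ I × j ≤ J × Admissible i I × Admissible j J × d ≡ P i j)
  biUnitary-P⁻ {d} I J b with P-divisor I J (biUnitary⇒∣ {d} b)
  ... | i , j , i≤I , j≤J , refl = i , j , i≤I , j≤J , adm-i , adm-j , refl
    where
    gcud≡1′ : gcud (P i j) (P (I ∸ i) (J ∸ j)) ≡ 1
    gcud≡1′ = to (biUnitary-cofactor {{P≢0 i j}} (P-split i≤I j≤J)) b
    trivial : ∀ {x y} → Extreme x i → Extreme y j → Extreme x (I ∸ i) → Extreme y (J ∸ j) → P x y ≡ 1
    trivial {x} {y} ex ey ex′ ey′ =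
      gcud≡1⇒common≡1 {{P≢0 i j}} gcud≡1′ {P x y} (unitary-P⁺ ex ey) (unitary-P⁺ ex′ ey′)
    adm-i : Admissible i I
    adm-i i+i≡I = proj₁ (P-injective {i} {0} {0} {0}
      (trivial {i} {0} (inj₂ refl) (inj₁ refl) (inj₂ (sym (half-complement i+i≡I))) (inj₁ refl)))
    adm-j : Admissible j J
    adm-j j+j≡J = proj₂ (P-injective {0} {0} {j} {0}
      (trivial {0} {j} (inj₁ refl) (inj₂ refl) (inj₁ refl) (inj₂ (sym (half-complement j+j≡J)))))

  biUnitaryCandidates : ℕ → ℕ → List ℕ
  biUnitaryCandidates I J = cartesianProductWith P (admissibleExponents I) (admissibleExponents J)

  -- The list of bi-unitary divisors of P I J is a rearrangement of the
  -- candidates: both lists are duplicate-free and have the same members.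
  biUnitaryDivisors-P : ∀ I J → biUnitaryDivisors (P I J) ↭ biUnitaryCandidates I J
  biUnitaryDivisors-P I J = ∼bag⇒↭ (unique∧set⇒bag
    (unique-biUnitaryDivisors (P I J))
    (Unique.cartesianProductWith⁺ P P-injective
      (unique-admissibleExponents I) (unique-admissibleExponents J))
    (mk⇔ fwd bwd))
    where
    fwd : ∀ {d} → d ∈ biUnitaryDivisors (P I J) → d ∈ biUnitaryCandidates I J
    fwd {d} d∈ with biUnitary-P⁻ {d} I J (to (∈-biUnitaryDivisors {n = P I J} {{P≢0 I J}}) d∈)
    ... | i , j , i≤I , j≤J , adm-i , adm-j , refl = ∈-cartesianProductWith⁺ P
      (from (∈-admissibleExponents {i} {I}) (i≤I , adm-i)) (from (∈-admissibleExponents {j} {J}) (j≤J , adm-j))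
    bwd : ∀ {d} → d ∈ biUnitaryCandidates I J → d ∈ biUnitaryDivisors (P I J)
    bwd d∈ with ∈-cartesianProductWith⁻ P (admissibleExponents I) (admissibleExponents J) d∈
    ... | i , j , i∈ , j∈ , refl
      with to (∈-admissibleExponents {i} {I}) i∈ | to (∈-admissibleExponents {j} {J}) j∈
    ...   | i≤I , adm-i | j≤J , adm-j =
      from (∈-biUnitaryDivisors {n = P I J} {{P≢0 I J}}) (biUnitary-P⁺ i≤I j≤J adm-i adm-j)

  -- For p³q² the admissible exponents are {0,1,2,3} and {0,2}, so
  -- σ**(p³q²) = (1 + p + p² + p³)(1 + q²) and d**(p³q²) = 8.
  σ**-p³q² : σ** (P 3 2) ≡ σ-p³q² p q
  σ**-p³q² = trans (sum-↭ (biUnitaryDivisors-P 3 2)) (factorise p q)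
    where
    -- the sum of 1, q², p, pq², p², p²q², p³, p³q² as the list unfolds
    factorise : ∀ p q →
      1 * 1 + (1 * (q * (q * 1)) + (p * 1 * 1 + (p * 1 * (q * (q * 1)) + (p * (p * 1) * 1
      + (p * (p * 1) * (q * (q * 1)) + (p * (p * (p * 1)) * 1 + (p * (p * (p * 1)) * (q * (q * 1)) + 0)))))))
        ≡ (1 + p) * (1 + p * p) * (1 + q * q)
    factorise = solve-∀

  d**-p³q² : d** (P 3 2) ≡ 8
  d**-p³q² = ↭-length (biUnitaryDivisors-P 3 2)

HarmonicCondition : ℕ → ℕ → Set
HarmonicCondition p q = σ-p³q² p q ∣ p ^ 3 * q ^ 2 * 8

-- The condition is decidable, which settles the finitely many remaining cases.
harmonic? : ∀ p q → Dec (HarmonicCondition p q)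
harmonic? p q = _ ∣? _

prime3 : Prime 3
prime3 = from-yes (prime? 3)

prime5 : Prime 5
prime5 = from-yes (prime? 5)

odd-prime≥3 : ∀ {p} → Prime p → p ≢ 2 → 3 ≤ p
odd-prime≥3 {p} pp p≢2 = ≤∧≢⇒< (nonTrivial⇒n>1 p {{prime⇒nonTrivial pp}}) (p≢2 ∘ sym)

-- The p-part of σ** divides 8q², since it is prime to p.
harmonic⇒p-part : ∀ {p q} → Prime p → HarmonicCondition p q → (1 + p) * (1 + p * p) ∣ q ^ 2 * 8
harmonic⇒p-part {p} {q} pp h =
  cancel-prime-power 3 pp p∤ (∣-trans (m∣m*n (1 + q * q)) (subst (σ-p³q² p q ∣_) (*-assoc (p ^ 3) (q ^ 2) 8) h))
  where
  expand : ∀ p → (1 + p) * (1 + p * p) ≡ 1 + p * (1 + p + p * p)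
  expand = solve-∀
  p∤ : ¬ p ∣ (1 + p) * (1 + p * p)
  p∤ = prime∤1+p* (1 + p + p * p) pp ∘ subst (p ∣_) (expand p)

-- The q-part of σ** divides 8p³, since it is prime to q.
harmonic⇒q-part : ∀ {p q} → Prime q → HarmonicCondition p q → 1 + q * q ∣ p ^ 3 * 8
harmonic⇒q-part {p} {q} pq h =
  cancel-prime-power 2 pq (prime∤1+p* q pq)
    (∣-trans (n∣m*n ((1 + p) * (1 + p * p))) (subst (σ-p³q² p q ∣_) swap h))
  where
  swap : p ^ 3 * q ^ 2 * 8 ≡ q ^ 2 * (p ^ 3 * 8)
  swap = trans (cong (_* 8) (*-comm (p ^ 3) (q ^ 2))) (*-assoc (q ^ 2) (p ^ 3) 8)

-- q = 2: then 5 ∣ 8p³ forces p = 5.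
harmonic-q≡2 : ∀ {p} → Prime p → ¬ HarmonicCondition p 2
harmonic-q≡2 {p} pp h = from-no (harmonic? 5 2) (subst (λ x → HarmonicCondition x 2) (sym 5≡p) h)
  where
  5≡p : 5 ≡ p
  5≡p = prime∣^*⇒≡ 3 prime5 pp (from-no (5 ∣? 8)) (harmonic⇒q-part {p} prime[2] h)

-- p = 2: then 3 ∣ 15 ∣ 8q² forces q = 3.
harmonic-p≡2 : ∀ {q} → Prime q → ¬ HarmonicCondition 2 q
harmonic-p≡2 {q} pq h = from-no (harmonic? 2 3) (subst (HarmonicCondition 2) (sym 3≡q) h)
  where
  3≡q : 3 ≡ q
  3≡q = prime∣^*⇒≡ 2 prime3 pq (from-no (3 ∣? 8))
    (∣-trans (from-yes (3 ∣? 15)) (harmonic⇒p-part {q = q} prime[2] h))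

1+p∣8⇒p≡3∨7 : ∀ {p} → 3 ≤ p → 1 + p ∣ 8 → p ≡ 3 ⊎ p ≡ 7
1+p∣8⇒p≡3∨7 {0} () _
1+p∣8⇒p≡3∨7 {1} (s≤s ()) _
1+p∣8⇒p≡3∨7 {2} (s≤s (s≤s ())) _
1+p∣8⇒p≡3∨7 {3} _ _ = inj₁ refl
1+p∣8⇒p≡3∨7 {4} _ 5∣8 = contradiction 5∣8 (from-no (5 ∣? 8))
1+p∣8⇒p≡3∨7 {5} _ 6∣8 = contradiction 6∣8 (from-no (6 ∣? 8))
1+p∣8⇒p≡3∨7 {6} _ 7∣8 = contradiction 7∣8 (from-no (7 ∣? 8))
1+p∣8⇒p≡3∨7 {7} _ _ = inj₂ refl
1+p∣8⇒p≡3∨7 {suc (suc (suc (suc (suc (suc (suc (suc p)))))))} _ d =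
  contradiction (≤-trans (m≤m+n 9 p) (∣⇒≤ d)) (from-no (9 ≤? 8))

-- p, q odd: the factor 1 + p² > 8 forces q ∣ 1 + p²; then q ∤ 1 + p (else
-- q ∣ (1 + p)² - (1 + p²) = 2p), so 1 + p ∣ 8, p ∈ {3, 7} and q ∣ 10 or q ∣ 50,
-- i.e. q = 5.
harmonic-odd : ∀ {p q} → Prime p → Prime q → p ≢ q → p ≢ 2 → q ≢ 2 → ¬ HarmonicCondition p q
harmonic-odd {p} {q} pp pq p≢q p≢2 q≢2 h =
  [ excluded 3 1 refl (from-no (harmonic? 3 5)) , excluded 7 2 refl (from-no (harmonic? 7 5)) ]′
    (1+p∣8⇒p≡3∨7 3≤p (cancel-prime-power 2 pq q∤1+p (∣-trans (m∣m*n _) p-part)))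
  where
  3≤p : 3 ≤ p
  3≤p = odd-prime≥3 pp p≢2
  p-part : (1 + p) * (1 + p * p) ∣ q ^ 2 * 8
  p-part = harmonic⇒p-part {q = q} pp h
  q∤2 : ¬ q ∣ 2
  q∤2 = q≢2 ∘ prime∣prime⇒≡ pq prime[2]
  q∣1+p² : q ∣ 1 + p * p
  q∣1+p² with q ∣? 1 + p * p
  ... | yes q∣ = q∣
  ... | no q∤ = contradiction
        (≤-trans (s≤s (*-mono-≤ 3≤p 3≤p))
          (∣⇒≤ (cancel-prime-power 2 pq q∤ (∣-trans (n∣m*n (1 + p)) p-part))))
        (from-no (10 ≤? 8))
  square : ∀ p → (1 + p) * (1 + p) ≡ (1 + p * p) + 2 * p
  square = solve-∀
  q∤1+p : ¬ q ∣ 1 + p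
  q∤1+p q∣ = [ q∤2 , p≢q ∘ sym ∘ prime∣prime⇒≡ pq pp ]′ (euclidsLemma 2 p pq
    (∣m+n∣m⇒∣n (subst (q ∣_) (square p) (∣m⇒∣m*n (1 + p) q∣)) q∣1+p²))
  -- p = p₀ with 1 + p₀² = 5^k · 2 forces q = 5, which is excluded by computation.
  excluded : ∀ p₀ k → 1 + p₀ * p₀ ≡ 5 ^ k * 2 → ¬ HarmonicCondition p₀ 5 → p ≢ p₀
  excluded p₀ k 1+p₀²≡ ¬h refl = ¬h (subst (HarmonicCondition p) q≡5 h)
    where
    q≡5 : q ≡ 5
    q≡5 = prime∣^*⇒≡ k pq prime5 q∤2 (subst (q ∣_) 1+p₀²≡ q∣1+p²)

no-harmonic-condition : ∀ {p q} → Prime p → Prime q → p ≢ q → ¬ HarmonicCondition p q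
no-harmonic-condition {p} {q} pp pq p≢q with p ≟ 2 | q ≟ 2
... | yes refl | _        = harmonic-p≡2 pq
... | no _     | yes refl = harmonic-q≡2 pp
... | no p≢2   | no q≢2   = harmonic-odd pp pq p≢q p≢2 q≢2

theorem4 : (p q : ℕ) → Prime p → Prime q → p ≢ q →
    ¬ BiUnitaryHarmonic (p ^ 3 * q ^ 2)
theorem4 p q pp pq p≢q harmonic =
  no-harmonic-condition pp pq p≢q
    (subst₂ _∣_ σ**-p³q² (cong (p ^ 3 * q ^ 2 *_) d**-p³q²) harmonic)
  where open TwoPrimes pp pq p≢q
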